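{- Let $\mathbf{a}=(a_1,\dots,a_n)$ be a weak composition and suppose there exist indices $1\le i<j\le n$ with $a_i<a_j$. Then $\mathbb{D}(\mathbf{a}s_{i,j})\in KD(\mathbb{D}(\mathbf{a}))$, where $\mathbf{a}s_{i,j}=(a_1,\dots,a_{i-1},a_j,a_{i+1},\dots,a_{j-1},a_i,a_{j+1},\dots,a_n)$ is obtained from $\mathbf{a}$ by exchanging the entries $a_i$ and $a_j$.
   Context: A diagram is a finite set $D$ of cells $(r,c)$ with $r,c$ positive integers; $r$ is the row (rows numbered from bottom to top starting at 1) and $c$ the column (numbered from left to right starting at 1). A Kohnert move at row $r$ applied to a diagram $D$: if row $r$ of $D$ is empty, $D$ is unchanged; otherwise let $(r,c)$ be the cell of row $r$ with the largest column index; if every position $(r',c)$ with $1\le r'<r$ belongs to $D$, then $D$ is unchanged; otherwise let $r'$ be the largest integer with $1\le r'<r$ and $(r',c)\notin D$, and the move replaces the cell $(r,c)$ by $(r',c)$. For a diagram $D_0$, $KD(D_0)$ is the set of all diagrams obtainable from $D_0$ by finite (possibly empty) sequences of Kohnert moves. For a weak composition $\mathbf{a}=(a_1,\dots,a_n)\in\mathbb{Z}_{\ge0}^n$, the key diagram is $\mathbb{D}(\mathbf{a})=\bigcup_{i=1}^n\{(i,j):1\le j\le a_i\}$. -}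

module Defs where

open import Data.Nat using (ℕ; zero; suc; _⊔_; _∸_; _<_)
open import Data.Nat.Properties using (_≟_)
open import Data.Fin using (Fin; toℕ)
open import Data.Product using (_×_; _,_; proj₁; proj₂; ∃-syntax)
open import Data.Product.Properties using (≡-dec)
open import Data.List using (List; []; _∷_; map; filter; foldr; concatMap; upTo)
open import Data.List.Relation.Binary.Subset.Propositional using (_⊆_)
open import Data.Maybe using (Maybe; just; nothing)
open import Data.Vec using (Vec; lookup; toList; allFin; _[_]≔_)
open import Relation.Nullary using (¬?; yes; no)
open import Relation.Binary.PropositionalEquality using (_≡_)
open import Relation.Binary using (DecidableEquality)

-- A cell (r , c): r = row (bottom to top, from 1), c = column (from 1).
Cell : Set
Cell = ℕ × ℕ

_≟ᶜ_ : DecidableEquality Cell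
_≟ᶜ_ = ≡-dec _≟_ _≟_

open import Data.List.Membership.DecPropositional _≟ᶜ_ public using (_∈_; _∈?_)

-- A diagram is a finite set of cells, represented by a list of cells
-- (order and multiplicity irrelevant; diagrams are compared by ≈D).
Diagram : Set
Diagram = List Cell

_≈D_ : Diagram → Diagram → Set
D ≈D E = (D ⊆ E) × (E ⊆ D)

rowCols : ℕ → Diagram → List ℕ
rowCols r D = map proj₂ (filter (λ x → proj₁ x ≟ r) D)

findGap : ℕ → ℕ → Diagram → Maybe ℕ
findGap zero    c D = nothing
findGap (suc k) c D with (suc k , c) ∈? D
... | yes _ = findGap k c D
... | no  _ = just (suc k)

removeCell : Cell → Diagram → Diagram
removeCell x D = filter (λ y → ¬? (y ≟ᶜ x)) D

kohnertMove : ℕ → Diagram → Diagram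
kohnertMove r D with rowCols r D
... | [] = D
... | cs@(_ ∷ _) with findGap (r ∸ 1) (foldr _⊔_ 0 cs) D
...   | nothing = D
...   | just r' = (r' , foldr _⊔_ 0 cs) ∷ removeCell (r , foldr _⊔_ 0 cs) D

data Reachable (D : Diagram) : Diagram → Set where
  done : Reachable D D
  step : ∀ {E} (r : ℕ) → Reachable D E → Reachable D (kohnertMove r E)

_∈KD_ : Diagram → Diagram → Set
E ∈KD D₀ = ∃[ F ] (Reachable D₀ F × (F ≈D E))

-- key diagram of a weak composition a = (a₁,…,aₙ): cells (i , j), 1 ≤ j ≤ aᵢ
keyDiagram : ∀ {n} → Vec ℕ n → Diagram
keyDiagram {n} a =
  concatMap (λ k → map (λ j → (suc (toℕ k) , suc j)) (upTo (lookup a k)))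
            (toList (allFin n))

swapEntries : ∀ {n} → Vec ℕ n → Fin n → Fin n → Vec ℕ n
swapEntries a i j = (a [ i ]≔ lookup a j) [ j ]≔ lookup a i

{-# OPTIONS --safe #-}
module Submission where

-- With L the row lengths, the cells of row J in columns L I + 1, …, L J are
-- carried down to row I one column at a time, from right to left.  The cell
-- (J , c) is the rightmost of its row, so a Kohnert move sends it to the highest
-- free position of column c below it; there it is again the rightmost cell of its
-- row, because a row between I and J without a cell in column c ends before
-- column c.  As (I , c) is free, the cell reaches row I after finitely many moves.
-- Once all these columns have moved, rows I and J have exchanged their lengths.

open import Defs
open import Data.Nat using (ℕ; zero; suc; _+_; _∸_; _⊔_; _≤_; _<_; z≤n; s≤s; _≤?_)
open import Data.Nat.Properties
  using ( _≟_; ≤-refl; ≤-reflexive; ≤-trans; ≤-antisym; ≤-pred; <⇒≤; <⇒≱; ≰⇒>; <-irrefl; ≤∧≢⇒<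
        ; n≤1+n; m≤n⇒m≤1+n; m≤n⇒m<n∨m≡n; m≤n+m; +-suc; m∸n+n≡m; ⊔-lub; m≤n⇒m≤n⊔o; m≤n⇒m≤o⊔n)
open import Data.Nat.Induction using (<-wellFounded)
open import Data.Fin using (Fin; toℕ) renaming (zero to fzero; suc to fsuc; _<_ to _<ᶠ_)
import Data.Fin.Properties as Fin
open import Data.Vec using (Vec; []; _∷_; lookup; toList; allFin; _[_]≔_)
open import Data.Vec.Properties using (lookup∘update; lookup∘update′)
open import Data.Vec.Membership.Propositional.Properties using (∈-allFin⁺; ∈-toList⁺)
open import Data.List using (_∷_; foldr; map; upTo)
open import Data.List.Properties using (foldr-preservesᵇ; foldr-preservesᵒ)
open import Data.List.Relation.Unary.Any using (here; there)
import Data.List.Relation.Unary.Any as Any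
import Data.List.Relation.Unary.All as All
import Data.List.Membership.Propositional as List
open import Data.List.Membership.Propositional.Properties
  using (∈-map⁺; ∈-map⁻; ∈-filter⁺; ∈-filter⁻; ∈-concatMap⁺; ∈-concatMap⁻; ∈-upTo⁺; ∈-upTo⁻)
open import Data.Maybe using (just)
open import Data.Product using (_×_; _,_; proj₁; proj₂; ∃-syntax; Σ-syntax)
open import Data.Sum using (inj₁; inj₂; [_,_])
open import Function using (_∘_)
open import Induction.WellFounded using (Acc; acc)
open import Level using (0ℓ)
open import Relation.Nullary using (¬_; ¬?; yes; no; contradiction)
open import Relation.Unary using (Pred; _∪_; ｛_｝; _≐_)
open import Relation.Unary.Properties using (≐-sym; ≐-trans)
open import Relation.Binary.PropositionalEquality
  using (_≡_; _≢_; refl; sym; trans; cong; subst; subst₂; module ≡-Reasoning)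

⟦_⟧ : Diagram → Pred Cell 0ℓ
⟦ D ⟧ = _∈ D

module _ {r : ℕ} {D : Diagram} where

  ∈-rowCols⁺ : ∀ {c} → (r , c) ∈ D → c List.∈ rowCols r D
  ∈-rowCols⁺ p = ∈-map⁺ proj₂ (∈-filter⁺ (λ y → proj₁ y ≟ r) p refl)

  ∈-rowCols⁻ : ∀ {c} → c List.∈ rowCols r D → (r , c) ∈ D
  ∈-rowCols⁻ p with _ , q , refl ← ∈-map⁻ proj₂ p
               with q′ , refl ← ∈-filter⁻ (λ y → proj₁ y ≟ r) {xs = D} q = q′

foldr-⊔-lub : ∀ {c} xs → (∀ {x} → x List.∈ xs → x ≤ c) → foldr _⊔_ 0 xs ≤ c
foldr-⊔-lub xs bound = foldr-preservesᵇ ⊔-lub z≤n (All.tabulate bound)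

foldr-⊔-upper : ∀ {c} xs → c List.∈ xs → c ≤ foldr _⊔_ 0 xs
foldr-⊔-upper xs c∈xs =
  foldr-preservesᵒ (λ x y → [ m≤n⇒m≤n⊔o y , m≤n⇒m≤o⊔n x ]) 0 xs (inj₂ (Any.map ≤-reflexive c∈xs))

max-rowCols : ∀ {r c D} → (r , c) ∈ D → (∀ {x} → (r , x) ∈ D → x ≤ c) →
              foldr _⊔_ 0 (rowCols r D) ≡ c
max-rowCols rc∈D bound =
  ≤-antisym (foldr-⊔-lub _ (bound ∘ ∈-rowCols⁻)) (foldr-⊔-upper _ (∈-rowCols⁺ rc∈D))

kohnertMove-moves : ∀ {r c r′ D} → (r , c) ∈ D → (∀ {x} → (r , x) ∈ D → x ≤ c) →
                    findGap (r ∸ 1) c D ≡ just r′ →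
                    kohnertMove r D ≡ (r′ , c) ∷ removeCell (r , c) D
kohnertMove-moves {r} {c} {r′} {D} rc∈D bound gap
  with rowCols r D | ∈-rowCols⁺ rc∈D | max-rowCols rc∈D bound
... | x ∷ xs | _ | refl with findGap (r ∸ 1) (foldr _⊔_ 0 (x ∷ xs)) D | gap
...   | just _ | refl = refl

findGap-below : ∀ {r c D} m → 1 ≤ r → r ≤ m → ¬ (r , c) ∈ D →
                ∃[ r′ ] (findGap m c D ≡ just r′ × r ≤ r′ × r′ ≤ m × ¬ (r′ , c) ∈ D)
findGap-below zero 1≤r r≤0 _ = contradiction r≤0 (<⇒≱ 1≤r)
findGap-below {r} {c} {D} (suc m) 1≤r r≤m rc∉D with (suc m , c) ∈? D
... | no m∉D = suc m , refl , r≤m , ≤-refl , m∉D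
... | yes m∈D with findGap-below m 1≤r (≤-pred (≤∧≢⇒< r≤m λ { refl → rc∉D m∈D })) rc∉D
...   | r′ , gap , r≤r′ , r′≤m , r′∉D = r′ , gap , r≤r′ , ≤-trans r′≤m (n≤1+n m) , r′∉D

replaceCell-≐ : ∀ {P : Pred Cell 0ℓ} {D z z′} → ¬ P z → ⟦ D ⟧ ≐ P ∪ ｛ z ｝ →
                ⟦ z′ ∷ removeCell z D ⟧ ≐ P ∪ ｛ z′ ｝
replaceCell-≐ {P} {D} {z} {z′} z∉P (D⊆ , ⊆D) = to , from
  where
  to : ∀ {y} → y ∈ (z′ ∷ removeCell z D) → (P ∪ ｛ z′ ｝) y
  to (here refl) = inj₂ refl
  to (there p) with y∈D , y≢z ← ∈-filter⁻ (λ y → ¬? (y ≟ᶜ z)) {xs = D} p with D⊆ y∈D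
  ... | inj₁ Py = inj₁ Py
  ... | inj₂ refl = contradiction refl y≢z
  from : ∀ {y} → (P ∪ ｛ z′ ｝) y → y ∈ (z′ ∷ removeCell z D)
  from (inj₂ refl) = here refl
  from (inj₁ Py) = there (∈-filter⁺ (λ y → ¬? (y ≟ᶜ z)) (⊆D (inj₁ Py)) λ { refl → z∉P Py })

module _ {D₀ : Diagram} (P : Pred Cell 0ℓ) {I c : ℕ} (1≤I : 1 ≤ I) (Ic∉P : ¬ P (I , c))
         (rowEndsBefore : ∀ {r x} → I < r → ¬ P (r , c) → P (r , x) → x < c) where

  slideOnce : ∀ {k D} → I < k → ¬ P (k , c) → ⟦ D ⟧ ≐ P ∪ ｛ (k , c) ｝ →
              ∃[ r′ ] (I ≤ r′ × r′ < k × ¬ P (r′ , c) × ⟦ kohnertMove k D ⟧ ≐ P ∪ ｛ (r′ , c) ｝)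
  slideOnce {suc k} {D} I<k kc∉P D≐
    with findGap-below k 1≤I (≤-pred I<k) ([ Ic∉P , (λ { refl → <-irrefl refl I<k }) ] ∘ proj₁ D≐)
  ... | r′ , gap , I≤r′ , r′≤k , r′c∉D =
    r′ , I≤r′ , s≤s r′≤k , r′c∉D ∘ proj₂ D≐ ∘ inj₁ ,
    subst (λ E → ⟦ E ⟧ ≐ P ∪ ｛ (r′ , c) ｝)
          (sym (kohnertMove-moves (proj₂ D≐ (inj₂ refl)) rowBound gap))
          (replaceCell-≐ kc∉P D≐)
    where
    rowBound : ∀ {x} → (suc k , x) ∈ D → x ≤ c
    rowBound kx∈D with proj₁ D≐ kx∈D
    ... | inj₁ kxP = <⇒≤ (rowEndsBefore I<k kc∉P kxP)
    ... | inj₂ refl = ≤-refl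

  slideDown : ∀ {k D} → Acc _<_ k → I ≤ k → ¬ P (k , c) → Reachable D₀ D → ⟦ D ⟧ ≐ P ∪ ｛ (k , c) ｝ →
              ∃[ E ] (Reachable D₀ E × ⟦ E ⟧ ≐ P ∪ ｛ (I , c) ｝)
  slideDown {k} {D} (acc rec) I≤k kc∉P R D≐ with k ≟ I
  ... | yes refl = D , R , D≐
  ... | no k≢I with slideOnce (≤∧≢⇒< I≤k (k≢I ∘ sym)) kc∉P D≐
  ...   | r′ , I≤r′ , r′<k , r′c∉P , D′≐ = slideDown (rec r′<k) I≤r′ r′c∉P (step k R) D′≐

Key : (ℕ → ℕ) → Pred Cell 0ℓ
Key L (r , x) = 1 ≤ x × x ≤ L r

rowLength : ∀ {n} → Vec ℕ n → ℕ → ℕ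
rowLength a       zero          = 0
rowLength []      (suc r)       = 0
rowLength (x ∷ a) (suc zero)    = x
rowLength (x ∷ a) (suc (suc r)) = rowLength a (suc r)

rowLength-lookup : ∀ {n} (a : Vec ℕ n) k → rowLength a (suc (toℕ k)) ≡ lookup a k
rowLength-lookup (x ∷ a) fzero    = refl
rowLength-lookup (x ∷ a) (fsuc k) = rowLength-lookup a k

rowLength-update : ∀ {n} (a : Vec ℕ n) k v {r} → r ≢ suc (toℕ k) →
                   rowLength (a [ k ]≔ v) r ≡ rowLength a r
rowLength-update a       k        v {zero}          _   = refl
rowLength-update (x ∷ a) fzero    v {suc zero}      r≢1 = contradiction refl r≢1
rowLength-update (x ∷ a) fzero    v {suc (suc r)}   _   = refl
rowLength-update (x ∷ a) (fsuc k) v {suc zero}      _   = refl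
rowLength-update (x ∷ a) (fsuc k) v {suc (suc r)} r≢k = rowLength-update a k v (r≢k ∘ cong suc)

rowLength-support : ∀ {n} (a : Vec ℕ n) r → 0 < rowLength a r → Σ[ k ∈ Fin n ] r ≡ suc (toℕ k)
rowLength-support (x ∷ a) (suc zero)    _   = fzero , refl
rowLength-support (x ∷ a) (suc (suc r)) pos with k , refl ← rowLength-support a (suc r) pos =
  fsuc k , refl

rowLength-swap₁ : ∀ {n} (a : Vec ℕ n) {i j} → i ≢ j →
                  rowLength (swapEntries a i j) (suc (toℕ i)) ≡ rowLength a (suc (toℕ j))
rowLength-swap₁ a {i} {j} i≢j = begin
  rowLength (swapEntries a i j) (suc (toℕ i)) ≡⟨ rowLength-lookup (swapEntries a i j) i ⟩
  lookup (swapEntries a i j) i                ≡⟨ lookup∘update′ i≢j (a [ i ]≔ lookup a j) (lookup a i) ⟩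
  lookup (a [ i ]≔ lookup a j) i              ≡⟨ lookup∘update i a (lookup a j) ⟩
  lookup a j                                  ≡⟨ rowLength-lookup a j ⟨
  rowLength a (suc (toℕ j))                   ∎
  where open ≡-Reasoning

rowLength-swap₂ : ∀ {n} (a : Vec ℕ n) i j →
                  rowLength (swapEntries a i j) (suc (toℕ j)) ≡ rowLength a (suc (toℕ i))
rowLength-swap₂ a i j = begin
  rowLength (swapEntries a i j) (suc (toℕ j)) ≡⟨ rowLength-lookup (swapEntries a i j) j ⟩
  lookup (swapEntries a i j) j                ≡⟨ lookup∘update j (a [ i ]≔ lookup a j) (lookup a i) ⟩
  lookup a i                                  ≡⟨ rowLength-lookup a i ⟨
  rowLength a (suc (toℕ i))                   ∎
  where open ≡-Reasoning

rowLength-swap-other : ∀ {n} (a : Vec ℕ n) i j {r} → r ≢ suc (toℕ i) → r ≢ suc (toℕ j) →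
                       rowLength (swapEntries a i j) r ≡ rowLength a r
rowLength-swap-other a i j r≢i r≢j =
  trans (rowLength-update (a [ i ]≔ lookup a j) j (lookup a i) r≢j)
        (rowLength-update a i (lookup a j) r≢i)

keyDiagram-≐ : ∀ {n} (a : Vec ℕ n) → ⟦ keyDiagram a ⟧ ≐ Key (rowLength a)
keyDiagram-≐ {n} a = to , from
  where
  row : Fin n → Diagram
  row k = map (λ j → (suc (toℕ k) , suc j)) (upTo (lookup a k))
  to : ∀ {y} → y ∈ keyDiagram a → Key (rowLength a) y
  to p with k , _ , q ← List.find (∈-concatMap⁻ row {xs = toList (allFin n)} p)
       with j , j<ak , refl ← ∈-map⁻ (λ j → (suc (toℕ k) , suc j)) q
       = s≤s z≤n , subst (suc j ≤_) (sym (rowLength-lookup a k)) (∈-upTo⁻ j<ak)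
  from : ∀ {y} → Key (rowLength a) y → y ∈ keyDiagram a
  from {r , suc j} (_ , x≤) with k , refl ← rowLength-support a r (≤-trans (s≤s z≤n) x≤) =
    ∈-concatMap⁺ row (List.lose (∈-toList⁺ (∈-allFin⁺ k))
      (∈-map⁺ (λ j → (suc (toℕ k) , suc j)) (∈-upTo⁺ (subst (suc j ≤_) (rowLength-lookup a k) x≤))))

module RowExchange (L L′ : ℕ → ℕ) {I J : ℕ} (1≤I : 1 ≤ I) (I<J : I < J) (LI<LJ : L I < L J)
                   (L′I : L′ I ≡ L J) (L′J : L′ J ≡ L I)
                   (L′-other : ∀ {r} → r ≢ I → r ≢ J → L′ r ≡ L r) where

  -- The key diagram of L after the cells of row J in columns m + 2, …, L J have
  -- been moved to row I, with column m + 1 empty in both rows.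
  data Core (m : ℕ) : Pred Cell 0ℓ where
    other : ∀ {r x} → r ≢ J → 1 ≤ x → x ≤ L r → Core m (r , x)
    rowJ  : ∀ {x} → 1 ≤ x → x ≤ m → Core m (J , x)
    tailI : ∀ {x} → suc m < x → x ≤ L J → Core m (I , x)

  Ic∉Core : ∀ {m} → L I ≤ m → ¬ Core m (I , suc m)
  Ic∉Core LI≤m (other _ _ m<LI) = <⇒≱ m<LI LI≤m
  Ic∉Core LI≤m (rowJ _ _)       = <-irrefl refl I<J
  Ic∉Core LI≤m (tailI m<m _)    = <-irrefl refl m<m

  Jc∉Core : ∀ {m} → ¬ Core m (J , suc m)
  Jc∉Core (other J≢J _ _) = J≢J refl
  Jc∉Core (rowJ _ m<m)    = <-irrefl refl m<m
  Jc∉Core (tailI _ _)     = <-irrefl refl I<J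

  Core-short : ∀ {m r x} → I < r → ¬ Core m (r , suc m) → Core m (r , x) → x < suc m
  Core-short I<r rc∉Core (other r≢J 1≤x x≤Lr) with _ ≤? _
  ... | yes x≤m = s≤s x≤m
  ... | no x≰m = contradiction (other r≢J (s≤s z≤n) (≤-trans (≰⇒> x≰m) x≤Lr)) rc∉Core
  Core-short I<r rc∉Core (rowJ _ x≤m) = s≤s x≤m
  Core-short I<I rc∉Core (tailI _ _)  = contradiction I<I (<-irrefl refl)

  Key≐initial : ∀ {m} → suc m ≡ L J → Key L ≐ Core m ∪ ｛ (J , suc m) ｝
  Key≐initial {m} m+1≡LJ = to , from
    where
    to : ∀ {y} → Key L y → (Core m ∪ ｛ (J , suc m) ｝) y
    to {r , x} (1≤x , x≤Lr) with r ≟ J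
    ... | no r≢J = inj₁ (other r≢J 1≤x x≤Lr)
    ... | yes refl with m≤n⇒m<n∨m≡n (subst (x ≤_) (sym m+1≡LJ) x≤Lr)
    ...   | inj₁ x≤m  = inj₁ (rowJ 1≤x (≤-pred x≤m))
    ...   | inj₂ refl = inj₂ refl
    from : ∀ {y} → (Core m ∪ ｛ (J , suc m) ｝) y → Key L y
    from (inj₁ (other _ 1≤x x≤Lr)) = 1≤x , x≤Lr
    from (inj₁ (rowJ 1≤x x≤m))     = 1≤x , ≤-trans (m≤n⇒m≤1+n x≤m) (≤-reflexive m+1≡LJ)
    from (inj₁ (tailI m<x x≤LJ))   = contradiction (≤-trans m<x x≤LJ) (<-irrefl m+1≡LJ)
    from (inj₂ refl)               = s≤s z≤n , ≤-reflexive m+1≡LJ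

  Core-step : ∀ {m} → suc (suc m) ≤ L J →
              Core (suc m) ∪ ｛ (I , suc (suc m)) ｝ ≐ Core m ∪ ｛ (J , suc m) ｝
  Core-step {m} hi = to , from
    where
    to : ∀ {y} → (Core (suc m) ∪ ｛ (I , suc (suc m)) ｝) y → (Core m ∪ ｛ (J , suc m) ｝) y
    to (inj₁ (other r≢J 1≤x x≤Lr)) = inj₁ (other r≢J 1≤x x≤Lr)
    to (inj₁ (rowJ 1≤x x≤m+1)) with m≤n⇒m<n∨m≡n x≤m+1
    ... | inj₁ x≤m  = inj₁ (rowJ 1≤x (≤-pred x≤m))
    ... | inj₂ refl = inj₂ refl
    to (inj₁ (tailI m+1<x x≤LJ))    = inj₁ (tailI (≤-trans (n≤1+n _) m+1<x) x≤LJ)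
    to (inj₂ refl)                  = inj₁ (tailI ≤-refl hi)
    from : ∀ {y} → (Core m ∪ ｛ (J , suc m) ｝) y → (Core (suc m) ∪ ｛ (I , suc (suc m)) ｝) y
    from (inj₁ (other r≢J 1≤x x≤Lr)) = inj₁ (other r≢J 1≤x x≤Lr)
    from (inj₁ (rowJ 1≤x x≤m))       = inj₁ (rowJ 1≤x (m≤n⇒m≤1+n x≤m))
    from (inj₁ (tailI m<x x≤LJ)) with m≤n⇒m<n∨m≡n m<x
    ... | inj₁ m+1<x = inj₁ (tailI m+1<x x≤LJ)
    ... | inj₂ refl  = inj₂ refl
    from (inj₂ refl)                 = inj₁ (rowJ (s≤s z≤n) ≤-refl)

  final≐Key : Core (L I) ∪ ｛ (I , suc (L I)) ｝ ≐ Key L′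
  final≐Key = to , from
    where
    to : ∀ {y} → (Core (L I) ∪ ｛ (I , suc (L I)) ｝) y → Key L′ y
    to (inj₁ (other {r} {x} r≢J 1≤x x≤Lr)) with r ≟ I
    ... | yes refl = 1≤x , subst (x ≤_) (sym L′I) (≤-trans x≤Lr (<⇒≤ LI<LJ))
    ... | no r≢I   = 1≤x , subst (x ≤_) (sym (L′-other r≢I r≢J)) x≤Lr
    to (inj₁ (rowJ {x} 1≤x x≤LI))   = 1≤x , subst (x ≤_) (sym L′J) x≤LI
    to (inj₁ (tailI {x} LI<x x≤LJ)) = ≤-trans (s≤s z≤n) LI<x , subst (x ≤_) (sym L′I) x≤LJ
    to (inj₂ refl)                  = s≤s z≤n , subst (suc (L I) ≤_) (sym L′I) LI<LJ
    from : ∀ {y} → Key L′ y → (Core (L I) ∪ ｛ (I , suc (L I)) ｝) y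
    from {r , x} (1≤x , x≤L′r) with r ≟ J | r ≟ I
    ... | yes refl | _     = inj₁ (rowJ 1≤x (subst (x ≤_) L′J x≤L′r))
    ... | no r≢J | no r≢I  = inj₁ (other r≢J 1≤x (subst (x ≤_) (L′-other r≢I r≢J) x≤L′r))
    ... | no r≢J | yes refl with x ≤? L I
    ...   | yes x≤LI = inj₁ (other r≢J 1≤x x≤LI)
    ...   | no x≰LI with m≤n⇒m<n∨m≡n (≰⇒> x≰LI)
    ...     | inj₁ LI+1<x = inj₁ (tailI LI+1<x (subst (x ≤_) L′I x≤L′r))
    ...     | inj₂ refl   = inj₂ refl

  module _ {D₀ : Diagram} where

    slideColumn : ∀ {m D} → L I ≤ m → Reachable D₀ D → ⟦ D ⟧ ≐ Core m ∪ ｛ (J , suc m) ｝ →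
                  ∃[ E ] (Reachable D₀ E × ⟦ E ⟧ ≐ Core m ∪ ｛ (I , suc m) ｝)
    slideColumn {m} LI≤m =
      slideDown (Core m) 1≤I (Ic∉Core LI≤m) Core-short (<-wellFounded J) (<⇒≤ I<J) Jc∉Core

    slideColumns : ∀ d {D} → d + L I < L J → Reachable D₀ D →
                   ⟦ D ⟧ ≐ Core (d + L I) ∪ ｛ (J , suc (d + L I)) ｝ →
                   ∃[ E ] (Reachable D₀ E × ⟦ E ⟧ ≐ Core (L I) ∪ ｛ (I , suc (L I)) ｝)
    slideColumns zero    _  = slideColumn ≤-refl
    slideColumns (suc d) hi R D≐ =
      let E , R′ , E≐ = slideColumn (m≤n+m (L I) (suc d)) R D≐
      in  slideColumns d (≤-trans (n≤1+n _) hi) R′ (≐-trans E≐ (Core-step hi))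

    exchangeRows : ⟦ D₀ ⟧ ≐ Key L → ∃[ E ] (Reachable D₀ E × ⟦ E ⟧ ≐ Key L′)
    exchangeRows D₀≐ =
      let E , R , E≐ = slideColumns d (≤-reflexive d+LI+1≡LJ) done
                                    (≐-trans D₀≐ (Key≐initial d+LI+1≡LJ))
      in  E , R , ≐-trans E≐ final≐Key
      where
      d : ℕ
      d = L J ∸ suc (L I)
      d+LI+1≡LJ : suc (d + L I) ≡ L J
      d+LI+1≡LJ = trans (sym (+-suc d (L I))) (m∸n+n≡m LI<LJ)

lemma6p15 : (n : ℕ) (a : Vec ℕ n) (i j : Fin n) →
    i <ᶠ j → lookup a i < lookup a j →
    keyDiagram (swapEntries a i j) ∈KD keyDiagram a
lemma6p15 n a i j i<j ai<aj =
  let E , R , E≐ = exchangeRows (keyDiagram-≐ a)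
  in  E , R , ≐-trans E≐ (≐-sym (keyDiagram-≐ (swapEntries a i j)))
  where
  open RowExchange (rowLength a) (rowLength (swapEntries a i j)) (s≤s z≤n) (s≤s i<j)
         (subst₂ _<_ (sym (rowLength-lookup a i)) (sym (rowLength-lookup a j)) ai<aj)
         (rowLength-swap₁ a (Fin.<⇒≢ i<j)) (rowLength-swap₂ a i j) (rowLength-swap-other a i j)
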